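{- Let $m\ge1$ and $n\ge3$ be integers, $G=K_m\,\square\,C_n$, and let $\mathcal{C}_0,\dots,\mathcal{C}_n$ be defined below for $\Delta_2^t(G)$ using the vertex order $x_j=(0,j)$, $0\le j\le n-1$. Let $\sigma\in\mathcal{C}_1$. (i) If $\sigma^c=\{(0,0),(0,j)\}$ for some $j\in\{1,\dots,n-1\}$, then $\sigma,\ \sigma\setminus\{(0,j-1)\}\notin\mathcal{C}_j$, and hence $\sigma,\ \sigma\setminus\{(0,j-1)\}\notin\mathcal{C}_n$. (ii) If, for some $i\in\{1,\dots,m-1\}$ and $j\in\{1,\dots,n-1\}$, we have $\{(0,1),(0,2),\dots,(0,j)\}\subseteq\sigma$, $\{(0,0),(i,j)\}\subseteq\sigma^c$ and $\sigma\setminus\{(0,j)\}\in\mathcal{C}_1$, then $\sigma,\ \sigma\setminus\{(0,j)\}\notin\mathcal{C}_n$.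
   Context: For a graph $G$, $\Delta_2^t(G)$ is the simplicial complex whose faces are the $\sigma\subseteq V(G)$ such that $\sigma^c:=V(G)\setminus\sigma$ contains two distinct non-adjacent vertices. $K_m\,\square\,C_n$ has vertex set $\{(i,j)\mid 0\le i\le m-1,\ 0\le j\le n-1\}$, with distinct $(i_1,j_1)\sim(i_2,j_2)$ iff either $i_1=i_2$ and $|j_1-j_2|\in\{1,n-1\}$, or $j_1=j_2$. Given vertices $x_0,\dots,x_{n-1}$, set $\mathcal{C}_0=\Delta_2^t(G)$ and for $0\le j\le n-1$ put $\mathcal{M}_{x_j}=\{\{\sigma\setminus\{x_j\},\sigma\cup\{x_j\}\}\mid \sigma\setminus\{x_j\},\sigma\cup\{x_j\}\in\mathcal{C}_j\}$ and $\mathcal{C}_{j+1}=\{\sigma\in\mathcal{C}_j\mid \sigma\text{ lies in no pair of }\mathcal{M}_{x_j}\}$. -}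

module Defs where

open import Data.Nat using (ℕ; zero; suc; _≤_; _<_; NonZero; ∣_-_∣; _∸_)
open import Data.Nat.Properties using (<⇒≤)
open import Data.Fin using (Fin; toℕ; fromℕ<)
open import Data.Fin.Properties renaming (_≟_ to _≟F_)
open import Data.Bool using (Bool; true; false; _∧_; _∨_; not)
open import Data.Product using (_×_; _,_; ∃; ∃-syntax)
open import Data.Product.Properties using (≡-dec)
open import Data.Sum using (_⊎_)
open import Relation.Nullary using (¬_; does)
open import Relation.Binary.PropositionalEquality using (_≡_; _≢_)

V : ℕ → ℕ → Set
V m n = Fin m × Fin n

Adj : {m n : ℕ} → V m n → V m n → Set
Adj {m} {n} (i₁ , j₁) (i₂ , j₂) =
  (i₁ , j₁) ≢ (i₂ , j₂) ×
  ((i₁ ≡ i₂ × (∣ toℕ j₁ - toℕ j₂ ∣ ≡ 1 ⊎ ∣ toℕ j₁ - toℕ j₂ ∣ ≡ n ∸ 1)) ⊎ j₁ ≡ j₂)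

Face : ℕ → ℕ → Set
Face m n = V m n → Bool

_==V_ : {m n : ℕ} → V m n → V m n → Bool
u ==V v = does (≡-dec _≟F_ _≟F_ u v)

_-ᵛ_ : {m n : ℕ} → Face m n → V m n → Face m n
(σ -ᵛ x) w = σ w ∧ not (w ==V x)

_+ᵛ_ : {m n : ℕ} → Face m n → V m n → Face m n
(σ +ᵛ x) w = σ w ∨ (w ==V x)

_≈F_ : {m n : ℕ} → Face m n → Face m n → Set
σ ≈F τ = ∀ w → σ w ≡ τ w

Δ₂ᵗ : {m n : ℕ} → Face m n → Set
Δ₂ᵗ {m} {n} σ = ∃[ u ] ∃[ v ] (u ≢ v × σ u ≡ false × σ v ≡ false × ¬ Adj u v)

-- σ lies in some pair {τ∖{x}, τ∪{x}} of M_x, both members in the complex C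
InMatchedPair : {m n : ℕ} → (Face m n → Set) → V m n → Face m n → Set
InMatchedPair C x σ =
  ∃[ τ ] (C (τ -ᵛ x) × C (τ +ᵛ x) × (σ ≈F (τ -ᵛ x) ⊎ σ ≈F (τ +ᵛ x)))

zeroF : (k : ℕ) → {{NonZero k}} → Fin k
zeroF (suc k) = Fin.zero

xv : {m n : ℕ} → {{NonZero m}} → Fin n → V m n
xv {m} j = (zeroF m , j)

C : (m n : ℕ) → {{NonZero m}} → (k : ℕ) → k ≤ n → Face m n → Set
C m n zero _ σ = Δ₂ᵗ σ
C m n (suc k) p σ =
  C m n k (<⇒≤ p) σ × ¬ InMatchedPair (C m n k (<⇒≤ p)) (xv (fromℕ< p)) σ

open import Data.Nat.Properties using (≤-trans; m∸n≤m; ≤-<-trans)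
open import Data.Fin.Properties using (toℕ<n)

3≤⇒1≤ : {n : ℕ} → 3 ≤ n → 1 ≤ n
3≤⇒1≤ (Data.Nat.s≤s _) = Data.Nat.s≤s Data.Nat.z≤n

fin0 : {n : ℕ} → 3 ≤ n → Fin n
fin0 p = fromℕ< (3≤⇒1≤ p)

predF : {n : ℕ} → Fin n → Fin n
predF {n} j = fromℕ< (≤-<-trans (m∸n≤m (toℕ j) 1) (toℕ<n j))

module Submission where

-- A face ρ ∈ 𝒞₁ stays in 𝒞_k as long as it is unmatched at x₁, …, x_{k-1}, and ρ
-- is unmatched at x_k as soon as ρ ∖ {x_k} ∉ 𝒞₁: a matched pair at x_k contains
-- ρ ∖ {x_k}, and 𝒞_k ⊆ 𝒞₁.  Below the relevant stage, ρ ∖ {(0,k)} has two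
-- non-adjacent holes avoiding (0,0) — (0,k) and (0,j) in (i), (0,k) and (i,j) in
-- (ii) — so it is matched at (0,0) and lies outside 𝒞₁.  Hence σ and its partner
-- σ ∖ {x}, with x = (0,j-1) in (i) and x = (0,j) in (ii), both survive to the stage
-- of x, where they form a matched pair and are removed together.  In (i) the partner
-- lies in 𝒞₁ because its union with (0,0) has only the adjacent holes (0,j-1), (0,j).

open import Defs renaming (_-ᵛ_ to infixl 6 _-ᵛ_; _+ᵛ_ to infixl 6 _+ᵛ_; _≈F_ to infix 4 _≈F_)
open import Data.Nat using (ℕ; zero; suc; _+_; _≤_; _<_; _∸_; ∣_-_∣; NonZero; z≤n; s≤s; s≤s⁻¹)
open import Data.Nat.Properties
  using (≤-refl; ≤-trans; <⇒≤; ≤-<-trans; ≤-irrelevant; ≤∧≢⇒<; <⇒≢; n<1+n; n≤1+n; m≤n⇒m<n∨m≡n;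
         m≤n⇒∣m-n∣≡n∸m; m≡n⇒∣m-n∣≡0; ∣-∣-comm; m+n≤o⇒m≤o∸n; m+n≤o⇒n≤o; m+[n∸m]≡n; m∸n≤m; ∸-monoˡ-≤)
open import Data.Fin using (Fin; toℕ; fromℕ<)
open import Data.Fin.Properties using (toℕ<n; toℕ-fromℕ<; fromℕ<-toℕ) renaming (_≟_ to _≟F_)
open import Data.Bool using (true; false; _∧_; _∨_; not)
open import Data.Bool.Properties using (∧-zeroʳ; ∨-zeroʳ; ∧-identityʳ; ∨-identityʳ; ¬-not)
open import Data.Product using (_×_; _,_; proj₁; proj₂)
open import Data.Product.Properties using (≡-dec)
open import Data.Sum using (_⊎_; inj₁; inj₂; [_,_]) renaming (map to ⊎-map)
open import Data.Empty using (⊥-elim)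
open import Function using (_∘_)
open import Relation.Binary.Definitions using (_Respects_)
open import Relation.Nullary using (¬_; yes; no)
open import Relation.Nullary.Decidable using (dec-true; dec-false)
open import Relation.Binary.PropositionalEquality using (_≡_; _≢_; refl; sym; trans; cong; subst; ≢-sym)

∣n-1+n∣≡1 : ∀ n → ∣ n - suc n ∣ ≡ 1
∣n-1+n∣≡1 zero    = refl
∣n-1+n∣≡1 (suc n) = ∣n-1+n∣≡1 n

far-apart-on-cycle : ∀ {a b n} → 2 + a ≤ b → 2 + b ≤ n → 1 < ∣ a - b ∣ × ∣ a - b ∣ < n ∸ 1
far-apart-on-cycle {a} {b} a+2≤b b+2≤n rewrite m≤n⇒∣m-n∣≡n∸m (m+n≤o⇒n≤o 2 a+2≤b) =
  m+n≤o⇒m≤o∸n 2 a+2≤b , ≤-<-trans (m∸n≤m b a) (∸-monoˡ-≤ 1 b+2≤n)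

toℕ-zeroF : ∀ m {{_ : NonZero m}} → toℕ (zeroF m) ≡ 0
toℕ-zeroF (suc m) = refl

suc-toℕ-predF : ∀ {n} (j : Fin n) → 1 ≤ toℕ j → suc (toℕ (predF j)) ≡ toℕ j
suc-toℕ-predF j 1≤j = trans (cong suc (toℕ-fromℕ< _)) (m+[n∸m]≡n 1≤j)

predF≢ : ∀ {n} (j : Fin n) → 1 ≤ toℕ j → toℕ (predF j) ≢ toℕ j
predF≢ j 1≤j e = <⇒≢ (n<1+n _) (trans e (sym (suc-toℕ-predF j 1≤j)))

module _ {m n : ℕ} where

  ≈F-sym : {σ τ : Face m n} → σ ≈F τ → τ ≈F σ
  ≈F-sym e w = sym (e w)

  ≈F-trans : {σ τ ρ : Face m n} → σ ≈F τ → τ ≈F ρ → σ ≈F ρ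
  ≈F-trans e e′ w = trans (e w) (e′ w)

  ==V-refl : (x : V m n) → (x ==V x) ≡ true
  ==V-refl x = dec-true (≡-dec _≟F_ _≟F_ x x) refl

  ==V-≢ : {x y : V m n} → x ≢ y → (x ==V y) ≡ false
  ==V-≢ {x} {y} = dec-false (≡-dec _≟F_ _≟F_ x y)

  remove-self : (σ : Face m n) (x : V m n) → (σ -ᵛ x) x ≡ false
  remove-self σ x rewrite ==V-refl x = ∧-zeroʳ (σ x)

  remove-hole : (σ : Face m n) (x : V m n) {w : V m n} → σ w ≡ false → (σ -ᵛ x) w ≡ false
  remove-hole σ x w∉σ rewrite w∉σ = refl

  add-hole : (σ : Face m n) {x w : V m n} → σ w ≡ false → w ≢ x → (σ +ᵛ x) w ≡ false
  add-hole σ w∉σ w≢x rewrite w∉σ | ==V-≢ w≢x = refl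

  remove-hole⁻¹ : (σ : Face m n) (x w : V m n) → (σ -ᵛ x) w ≡ false → σ w ≡ false ⊎ w ≡ x
  remove-hole⁻¹ σ x w h with σ w | ≡-dec _≟F_ _≟F_ w x
  ... | false | _     = inj₁ refl
  ... | true  | yes e = inj₂ e

  add-hole⁻¹ : (σ : Face m n) (x w : V m n) → (σ +ᵛ x) w ≡ false → σ w ≡ false × w ≢ x
  add-hole⁻¹ σ x w h with σ w | ≡-dec _≟F_ _≟F_ w x
  ... | false | no w≢x = refl , w≢x

  remove-absent : (σ : Face m n) {x : V m n} → σ x ≡ false → σ ≈F σ -ᵛ x
  remove-absent σ {x} x∉σ w with ≡-dec _≟F_ _≟F_ w x
  ... | yes refl = trans x∉σ (sym (∧-zeroʳ (σ w)))
  ... | no  _    = sym (∧-identityʳ (σ w))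

  add-present : (σ : Face m n) {x : V m n} → σ x ≡ true → σ ≈F σ +ᵛ x
  add-present σ {x} x∈σ w with ≡-dec _≟F_ _≟F_ w x
  ... | yes refl = trans x∈σ (sym (∨-zeroʳ (σ w)))
  ... | no  _    = sym (∨-identityʳ (σ w))

  ≈-remove-or-add : (σ : Face m n) (x : V m n) → σ ≈F σ -ᵛ x ⊎ σ ≈F σ +ᵛ x
  ≈-remove-or-add σ x with σ x in e
  ... | false = inj₁ (remove-absent σ e)
  ... | true  = inj₂ (add-present σ e)

  remove-cong : {σ τ : Face m n} (x : V m n) → σ ≈F τ → σ -ᵛ x ≈F τ -ᵛ x
  remove-cong x e w = cong (_∧ not (w ==V x)) (e w)

  add-cong : {σ τ : Face m n} (x : V m n) → σ ≈F τ → σ +ᵛ x ≈F τ +ᵛ x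
  add-cong x e w = cong (_∨ (w ==V x)) (e w)

  remove-remove : (σ : Face m n) (x : V m n) → σ -ᵛ x -ᵛ x ≈F σ -ᵛ x
  remove-remove σ x w with σ w | w ==V x
  ... | false | _     = refl
  ... | true  | false = refl
  ... | true  | true  = refl

  add-remove : (σ : Face m n) (x : V m n) → σ -ᵛ x +ᵛ x ≈F σ +ᵛ x
  add-remove σ x w with σ w | w ==V x
  ... | false | _     = refl
  ... | true  | false = refl
  ... | true  | true  = refl

  remove-add : (σ : Face m n) (x : V m n) → σ +ᵛ x -ᵛ x ≈F σ -ᵛ x
  remove-add σ x w with σ w | w ==V x
  ... | false | false = refl
  ... | false | true  = refl
  ... | true  | false = refl
  ... | true  | true  = refl

  add-add : (σ : Face m n) (x : V m n) → σ +ᵛ x +ᵛ x ≈F σ +ᵛ x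
  add-add σ x w with σ w | w ==V x
  ... | false | false = refl
  ... | false | true  = refl
  ... | true  | false = refl
  ... | true  | true  = refl

  same-pair : {σ τ : Face m n} (x : V m n) → σ ≈F τ -ᵛ x ⊎ σ ≈F τ +ᵛ x →
              σ -ᵛ x ≈F τ -ᵛ x × σ +ᵛ x ≈F τ +ᵛ x
  same-pair {τ = τ} x (inj₁ e) =
    ≈F-trans (remove-cong x e) (remove-remove τ x) , ≈F-trans (add-cong x e) (add-remove τ x)
  same-pair {τ = τ} x (inj₂ e) =
    ≈F-trans (remove-cong x e) (remove-add τ x) , ≈F-trans (add-cong x e) (add-add τ x)

  InMatchedPair-respects : (D : Face m n → Set) (x : V m n) → InMatchedPair D x Respects _≈F_
  InMatchedPair-respects D x σ≈σ′ (τ , d⁻ , d⁺ , σ∈pair) =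
    τ , d⁻ , d⁺ , ⊎-map (≈F-trans (≈F-sym σ≈σ′)) (≈F-trans (≈F-sym σ≈σ′)) σ∈pair

  InMatchedPair-self : (D : Face m n → Set) (x : V m n) (σ : Face m n) →
                       D (σ -ᵛ x) → D (σ +ᵛ x) → InMatchedPair D x σ
  InMatchedPair-self D x σ d⁻ d⁺ = σ , d⁻ , d⁺ , ≈-remove-or-add σ x

  InMatchedPair-members : {D : Face m n → Set} {x : V m n} {σ : Face m n} → D Respects _≈F_ →
                          InMatchedPair D x σ → D (σ -ᵛ x) × D (σ +ᵛ x)
  InMatchedPair-members {x = x} {σ} resp (τ , d⁻ , d⁺ , σ∈pair) =
    resp (≈F-sym (proj₁ pair≈)) d⁻ , resp (≈F-sym (proj₂ pair≈)) d⁺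
    where
      pair≈ : σ -ᵛ x ≈F τ -ᵛ x × σ +ᵛ x ≈F τ +ᵛ x
      pair≈ = same-pair x σ∈pair

  Δ₂ᵗ-respects : Δ₂ᵗ {m} {n} Respects _≈F_
  Δ₂ᵗ-respects e (u , v , u≢v , u∉σ , v∉σ , u≁v) =
    u , v , u≢v , trans (sym (e u)) u∉σ , trans (sym (e v)) v∉σ , u≁v

  Adj-sym : {u v : V m n} → Adj u v → Adj v u
  Adj-sym {_ , a} {_ , b} (u≢v , inj₁ (i≡i′ , d)) =
    ≢-sym u≢v , inj₁ (sym i≡i′ , ⊎-map (trans swap) (trans swap) d)
    where
      swap : ∣ toℕ b - toℕ a ∣ ≡ ∣ toℕ a - toℕ b ∣
      swap = ∣-∣-comm (toℕ b) (toℕ a)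
  Adj-sym (u≢v , inj₂ j≡j′) = ≢-sym u≢v , inj₂ (sym j≡j′)

  Δ₂ᵗ⇒holes-¬Adj : {σ : Face m n} {a b : V m n} →
                   (∀ v → σ v ≡ false → v ≡ a ⊎ v ≡ b) → Δ₂ᵗ σ → ¬ Adj a b
  Δ₂ᵗ⇒holes-¬Adj holes (u , v , u≢v , u∉σ , v∉σ , u≁v) with holes u u∉σ | holes v v∉σ
  ... | inj₁ refl | inj₁ refl = ⊥-elim (u≢v refl)
  ... | inj₁ refl | inj₂ refl = u≁v
  ... | inj₂ refl | inj₁ refl = u≁v ∘ Adj-sym
  ... | inj₂ refl | inj₂ refl = ⊥-elim (u≢v refl)

  ≢-by-column : {i i′ : Fin m} {a b : Fin n} → toℕ a ≢ toℕ b → (i , a) ≢ (i′ , b)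
  ≢-by-column a≢b e = a≢b (cong (toℕ ∘ proj₂) e)

  Adj-row : (i : Fin m) {a b : Fin n} → toℕ a ≢ toℕ b →
            ∣ toℕ a - toℕ b ∣ ≡ 1 ⊎ ∣ toℕ a - toℕ b ∣ ≡ n ∸ 1 → Adj (i , a) (i , b)
  Adj-row i a≢b d = ≢-by-column a≢b , inj₁ (refl , d)

  Adj-predF : (i : Fin m) (j : Fin n) → 1 ≤ toℕ j → Adj (i , predF j) (i , j)
  Adj-predF i j 1≤j = Adj-row i (predF≢ j 1≤j)
    (inj₁ (subst (λ t → ∣ toℕ (predF j) - t ∣ ≡ 1) (suc-toℕ-predF j 1≤j) (∣n-1+n∣≡1 (toℕ (predF j)))))

  ¬Adj-row : (i : Fin m) {a b : Fin n} →
             1 < ∣ toℕ a - toℕ b ∣ → ∣ toℕ a - toℕ b ∣ < n ∸ 1 → ¬ Adj (i , a) (i , b)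
  ¬Adj-row i far near (_ , inj₁ (_ , inj₁ d)) = <⇒≢ far (sym d)
  ¬Adj-row i far near (_ , inj₁ (_ , inj₂ d)) = <⇒≢ near d
  ¬Adj-row i far near (_ , inj₂ a≡b) = <⇒≢ (≤-trans (n≤1+n 1) far) (sym (m≡n⇒∣m-n∣≡0 (cong toℕ a≡b)))

  ¬Adj-cross : {i i′ : Fin m} {a b : Fin n} → i ≢ i′ → a ≢ b → ¬ Adj (i , a) (i′ , b)
  ¬Adj-cross i≢i′ _   (_ , inj₁ (i≡i′ , _)) = i≢i′ i≡i′
  ¬Adj-cross _   a≢b (_ , inj₂ a≡b)       = a≢b a≡b

module _ {m n : ℕ} {{_ : NonZero m}} where

  C-respects : (k : ℕ) (p : k ≤ n) → C m n k p Respects _≈F_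
  C-respects zero    p e σ∈Δ = Δ₂ᵗ-respects e σ∈Δ
  C-respects (suc k) p e (σ∈C , unmatched) =
    C-respects k (<⇒≤ p) e σ∈C ,
    unmatched ∘ InMatchedPair-respects (C m n k (<⇒≤ p)) (xv (fromℕ< p)) (≈F-sym e)

  C-irrelevant : {k : ℕ} (p q : k ≤ n) {σ : Face m n} → C m n k p σ → C m n k q σ
  C-irrelevant p q σ∈C rewrite ≤-irrelevant p q = σ∈C

  C-antitone : {k l : ℕ} (p : k ≤ n) (q : l ≤ n) → k ≤ l → {σ : Face m n} → C m n l q σ → C m n k p σ
  C-antitone {l = zero}  p q z≤n = C-irrelevant q p
  C-antitone {l = suc l} p q k≤1+l with m≤n⇒m<n∨m≡n k≤1+l
  ... | inj₁ (s≤s k≤l) = C-antitone p (<⇒≤ q) k≤l ∘ proj₁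
  ... | inj₂ refl      = C-irrelevant q p

  ¬C-suc : (k : Fin n) {σ : Face m n} →
           InMatchedPair (C m n (toℕ k) (<⇒≤ (toℕ<n k))) (xv k) σ → ¬ C m n (suc (toℕ k)) (toℕ<n k) σ
  ¬C-suc k {σ} matched (_ , unmatched) =
    unmatched (subst (λ x → InMatchedPair (C m n (toℕ k) (<⇒≤ (toℕ<n k))) (xv x) σ)
                     (sym (fromℕ<-toℕ k (toℕ<n k))) matched)

  removal-pair-leaves : (k : Fin n) {σ : Face m n} → σ (xv k) ≡ true →
    C m n (toℕ k) (<⇒≤ (toℕ<n k)) σ → C m n (toℕ k) (<⇒≤ (toℕ<n k)) (σ -ᵛ xv k) →
    {l : ℕ} (q : l ≤ n) → toℕ k < l → ¬ C m n l q σ × ¬ C m n l q (σ -ᵛ xv k)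
  removal-pair-leaves k {σ} x∈σ σ∈C σ-x∈C q k<l =
    ¬C-suc k (σ , σ-x∈C , σ+x∈C , inj₂ (add-present σ x∈σ)) ∘ C-antitone (toℕ<n k) q k<l ,
    ¬C-suc k (σ , σ-x∈C , σ+x∈C , inj₁ (λ _ → refl)) ∘ C-antitone (toℕ<n k) q k<l
    where
      σ+x∈C : C m n (toℕ k) (<⇒≤ (toℕ<n k)) (σ +ᵛ xv k)
      σ+x∈C = C-respects _ _ (add-present σ x∈σ) σ∈C

module _ {m n : ℕ} {{_ : NonZero m}} (1≤n : 1 ≤ n) where

  private
    x₀ : V m n
    x₀ = xv (fromℕ< 1≤n)

  ≢x₀ : {i : Fin m} {a : Fin n} → 1 ≤ toℕ a → (i , a) ≢ x₀
  ≢x₀ 1≤a = ≢-by-column (λ a≡0 → <⇒≢ 1≤a (sym (trans a≡0 (toℕ-fromℕ< 1≤n))))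

  C₁-intro : {σ : Face m n} → Δ₂ᵗ σ → ¬ Δ₂ᵗ (σ +ᵛ x₀) → C m n 1 1≤n σ
  C₁-intro σ∈Δ σ+x₀∉Δ = σ∈Δ , σ+x₀∉Δ ∘ proj₂ ∘ InMatchedPair-members Δ₂ᵗ-respects

  remove-∉C₁ : (ρ : Face m n) {a b : V m n} → ρ b ≡ false →
    a ≢ b → a ≢ x₀ → b ≢ x₀ → ¬ Adj a b → ¬ C m n 1 1≤n (ρ -ᵛ a)
  remove-∉C₁ ρ {a} {b} b∉ρ a≢b a≢x₀ b≢x₀ a≁b (_ , unmatched) =
    unmatched (InMatchedPair-self Δ₂ᵗ x₀ (ρ -ᵛ a)
      (a , b , a≢b , remove-hole (ρ -ᵛ a) x₀ a∉ρ′ , remove-hole (ρ -ᵛ a) x₀ b∉ρ′ , a≁b)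
      (a , b , a≢b , add-hole (ρ -ᵛ a) a∉ρ′ a≢x₀ , add-hole (ρ -ᵛ a) b∉ρ′ b≢x₀ , a≁b))
    where
      a∉ρ′ : (ρ -ᵛ a) a ≡ false
      a∉ρ′ = remove-self ρ a
      b∉ρ′ : (ρ -ᵛ a) b ≡ false
      b∉ρ′ = remove-hole ρ a b∉ρ

  C-climb : (K : ℕ) (p : K ≤ n) → 1 ≤ K → {ρ : Face m n} → C m n 1 1≤n ρ →
    ((k : Fin n) → 1 ≤ toℕ k → toℕ k < K → ¬ C m n 1 1≤n (ρ -ᵛ xv k)) → C m n K p ρ
  C-climb (suc zero)    p _ ρ∈C₁ _      = C-irrelevant 1≤n p ρ∈C₁
  C-climb (suc (suc K)) p _ ρ∈C₁ leaves =
    C-climb (suc K) (<⇒≤ p) (s≤s z≤n) ρ∈C₁ (λ k 1≤k k<1+K → leaves k 1≤k (≤-trans k<1+K (n≤1+n _))) ,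
    λ matched → leaves (fromℕ< p)
      (subst (1 ≤_) (sym toℕ-xK) (s≤s z≤n)) (subst (_< suc (suc K)) (sym toℕ-xK) ≤-refl)
      (C-antitone 1≤n (<⇒≤ p) (s≤s z≤n)
        (proj₁ (InMatchedPair-members (C-respects (suc K) (<⇒≤ p)) matched)))
    where
      toℕ-xK : toℕ (fromℕ< p) ≡ suc K
      toℕ-xK = toℕ-fromℕ< p

  x₀-non-neighbour : (j : Fin n) → 1 ≤ toℕ j → ¬ Adj x₀ (xv j) → 2 ≤ toℕ j × 2 + toℕ j ≤ n
  x₀-non-neighbour j 1≤j x₀≁xj =
    ≤∧≢⇒< 1≤j (λ 1≡j → x₀≁xj (x₀-xj-Adj (inj₁ (sym 1≡j)))) ,
    ≤∧≢⇒< (toℕ<n j) (λ 1+j≡n → x₀≁xj (x₀-xj-Adj (inj₂ (cong (_∸ 1) 1+j≡n))))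
    where
      x₀-xj-distance : ∣ toℕ (fromℕ< 1≤n) - toℕ j ∣ ≡ toℕ j
      x₀-xj-distance = cong (λ z → ∣ z - toℕ j ∣) (toℕ-fromℕ< 1≤n)
      x₀-xj-Adj : toℕ j ≡ 1 ⊎ toℕ j ≡ n ∸ 1 → Adj x₀ (xv j)
      x₀-xj-Adj d =
        ≢-sym (≢x₀ 1≤j) , inj₁ (refl , ⊎-map (trans x₀-xj-distance) (trans x₀-xj-distance) d)

  predF-partner-∈C₁ : (σ : Face m n) (j : Fin n) → 1 ≤ toℕ j →
    (∀ v → σ v ≡ false → v ≡ x₀ ⊎ v ≡ xv j) → σ x₀ ≡ false → σ (xv j) ≡ false → ¬ Adj x₀ (xv j) →
    C m n 1 1≤n (σ -ᵛ xv (predF j))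
  predF-partner-∈C₁ σ j 1≤j holes x₀∉σ xj∉σ x₀≁xj =
    C₁-intro (x₀ , xv j , ≢x₀ 1≤j ∘ sym , remove-hole σ x′ x₀∉σ , remove-hole σ x′ xj∉σ , x₀≁xj)
             (λ σ′+x₀∈Δ → Δ₂ᵗ⇒holes-¬Adj σ′+x₀-holes σ′+x₀∈Δ (Adj-predF (zeroF m) j 1≤j))
    where
      x′ : V m n
      x′ = xv (predF j)
      σ′+x₀-holes : ∀ v → (σ -ᵛ x′ +ᵛ x₀) v ≡ false → v ≡ x′ ⊎ v ≡ xv j
      σ′+x₀-holes v h with add-hole⁻¹ (σ -ᵛ x′) x₀ v h
      ... | v∉σ′ , v≢x₀ = [ [ ⊥-elim ∘ v≢x₀ , inj₂ ] ∘ holes v , inj₁ ] (remove-hole⁻¹ σ x′ v v∉σ′)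

  two-holes-leave : (σ : Face m n) → C m n 1 1≤n σ → (j : Fin n) → 1 ≤ toℕ j →
    (∀ v → σ v ≡ false → v ≡ x₀ ⊎ v ≡ xv j) → σ x₀ ≡ false → σ (xv j) ≡ false →
    {l : ℕ} (q : l ≤ n) → toℕ j ≤ l → ¬ C m n l q σ × ¬ C m n l q (σ -ᵛ xv (predF j))
  two-holes-leave σ σ∈C₁ j 1≤j holes x₀∉σ xj∉σ {l} q j≤l =
    removal-pair-leaves (predF j) x′∈σ (climb σ σ∈C₁ xj∉σ)
      (climb (σ -ᵛ x′) (predF-partner-∈C₁ σ j 1≤j holes x₀∉σ xj∉σ x₀≁xj) (remove-hole σ x′ xj∉σ))
      q (subst (_≤ l) (sym 1+j-1≡j) j≤l)
    where
      x′ : V m n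
      x′ = xv (predF j)
      1+j-1≡j : suc (toℕ (predF j)) ≡ toℕ j
      1+j-1≡j = suc-toℕ-predF j 1≤j
      x₀≁xj : ¬ Adj x₀ (xv j)
      x₀≁xj = Δ₂ᵗ⇒holes-¬Adj holes (proj₁ σ∈C₁)
      bounds : 2 ≤ toℕ j × 2 + toℕ j ≤ n
      bounds = x₀-non-neighbour j 1≤j x₀≁xj
      1≤j-1 : 1 ≤ toℕ (predF j)
      1≤j-1 = s≤s⁻¹ (subst (2 ≤_) (sym 1+j-1≡j) (proj₁ bounds))

      x′∈σ : σ x′ ≡ true
      x′∈σ = ¬-not λ x′∉σ → [ ≢x₀ 1≤j-1 , ≢-by-column (predF≢ j 1≤j) ] (holes x′ x′∉σ)

      climb : (ρ : Face m n) → C m n 1 1≤n ρ → ρ (xv j) ≡ false →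
              C m n (toℕ (predF j)) (<⇒≤ (toℕ<n (predF j))) ρ
      climb ρ ρ∈C₁ xj∉ρ = C-climb _ _ 1≤j-1 ρ∈C₁ λ k 1≤k k<j-1 →
        let k+2≤j = subst (2 + toℕ k ≤_) 1+j-1≡j (s≤s k<j-1)
            far , near = far-apart-on-cycle k+2≤j (proj₂ bounds)
        in remove-∉C₁ ρ xj∉ρ (≢-by-column (<⇒≢ (≤-trans (n≤1+n _) k+2≤j))) (≢x₀ 1≤k) (≢x₀ 1≤j)
                      (¬Adj-row _ far near)

  off-row-hole-leaves : (σ : Face m n) → C m n 1 1≤n σ →
    (i : Fin m) → 1 ≤ toℕ i → (j : Fin n) → 1 ≤ toℕ j →
    σ (xv j) ≡ true → σ (i , j) ≡ false → C m n 1 1≤n (σ -ᵛ xv j) →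
    {l : ℕ} (q : l ≤ n) → toℕ j < l → ¬ C m n l q σ × ¬ C m n l q (σ -ᵛ xv j)
  off-row-hole-leaves σ σ∈C₁ i 1≤i j 1≤j xj∈σ ij∉σ σ′∈C₁ =
    removal-pair-leaves j xj∈σ (climb σ σ∈C₁ ij∉σ)
      (climb (σ -ᵛ xv j) σ′∈C₁ (remove-hole σ (xv j) ij∉σ))
    where
      row₀≢i : zeroF m ≢ i
      row₀≢i e = <⇒≢ 1≤i (trans (sym (toℕ-zeroF m)) (cong toℕ e))
      climb : (ρ : Face m n) → C m n 1 1≤n ρ → ρ (i , j) ≡ false → C m n (toℕ j) (<⇒≤ (toℕ<n j)) ρ
      climb ρ ρ∈C₁ ij∉ρ = C-climb _ _ 1≤j ρ∈C₁ λ k 1≤k k<j →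
        remove-∉C₁ ρ ij∉ρ (≢-by-column (<⇒≢ k<j)) (≢x₀ 1≤k) (≢x₀ 1≤j)
                   (¬Adj-cross row₀≢i (<⇒≢ k<j ∘ cong toℕ))

proposition3p13 : (m n : ℕ) → {{_ : NonZero m}} → (hn : 3 ≤ n) →
    (σ : Face m n) → C m n 1 (3≤⇒1≤ hn) σ →
    ((j : Fin n) → 1 ≤ toℕ j →
      ((v : V m n) → (σ v ≡ false → (v ≡ xv (fin0 hn) ⊎ v ≡ xv j)) × ((v ≡ xv (fin0 hn) ⊎ v ≡ xv j) → σ v ≡ false)) →
      (¬ C m n (toℕ j) (<⇒≤ (toℕ<n j)) σ × ¬ C m n (toℕ j) (<⇒≤ (toℕ<n j)) (σ -ᵛ xv (predF j)))
      × (¬ C m n n ≤-refl σ × ¬ C m n n ≤-refl (σ -ᵛ xv (predF j))))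
    ×
    ((i : Fin m) → 1 ≤ toℕ i → (j : Fin n) → 1 ≤ toℕ j →
      ((k : Fin n) → 1 ≤ toℕ k → toℕ k ≤ toℕ j → σ (xv k) ≡ true) →
      σ (xv (fin0 hn)) ≡ false → σ (i , j) ≡ false →
      C m n 1 (3≤⇒1≤ hn) (σ -ᵛ xv j) →
      ¬ C m n n ≤-refl σ × ¬ C m n n ≤-refl (σ -ᵛ xv j))
proposition3p13 m n hn σ σ∈C₁ =
  (λ j 1≤j holes →
    let leaves = two-holes-leave (3≤⇒1≤ hn) σ σ∈C₁ j 1≤j (proj₁ ∘ holes)
                   (proj₂ (holes _) (inj₁ refl)) (proj₂ (holes _) (inj₂ refl))
    in leaves (<⇒≤ (toℕ<n j)) ≤-refl , leaves ≤-refl (<⇒≤ (toℕ<n j))) ,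
  -- Only (0,j) ∈ σ is needed from the column hypothesis, and (0,0) ∉ σ not at all.
  (λ i 1≤i j 1≤j column _ ij∉σ σ′∈C₁ →
    off-row-hole-leaves (3≤⇒1≤ hn) σ σ∈C₁ i 1≤i j 1≤j (column j 1≤j ≤-refl) ij∉σ σ′∈C₁
      ≤-refl (toℕ<n j))
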